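{- Let $X$ be a finite set, $\alpha:X\to X$ a bijection and $E\subseteq X$ such that $(X,\alpha)$ is $E$-bound, and consider the micro-macro system $(X,[0,L],e,\alpha)$ with macrostates $X_k=e^{ -1}(k)$, $k\in[0,L]$, and $X_{L+1}=\emptyset$. (a) $E=X_0$ is an equilibrium macrostate (of maximal size). $S(\alpha i)\ge S(i)$ for every $i\in X^{\mathrm{neq}}$. If $E$ is $s$-stable, then $X^{\mathrm{eq}}$ is $s$-stable. For $k\in[0,L]$, $$|[\![E,X_k]\!]|=|X_k|-|X_{k+1}|,\qquad |X_k|=\sum_{t=k}^{L}|[\![E,X_t]\!]|,$$ and the transition matrix satisfies $[\alpha]_{jk}=\delta_{j-1,k}$ for $j\ge1$ and $[\alpha]_{0k}=\frac{|X_k|-|X_{k+1}|}{|E|}$. Assume now that $e(\alpha(E))=[0,L]$. (b) $X^{\mathrm{eq}}=E$, $X^{\mathrm{neq}}=X\setminus E$, $D=\{i\in X^{\mathrm{eq}}:\alpha i\in X^{\mathrm{neq}}\}$, entropy is strictly increasing on $X^{\mathrm{neq}}$ (i.e. $S(\alpha i)>S(i)$ for $i\in X^{\mathrm{neq}}$), and $|D|=|X_1|$, $|I|=|X^{\mathrm{neq}}|$, $|C|=|X^{\mathrm{eq}}|-|X_1|$. (c) The mean (with respect to the uniform distribution on $X$) of the arrow-of-time length $\mathcal A$ is $$\langle\mathcal A\rangle=\frac{1}{|X|}\sum_{k=1}^{L}k|X_k|=\frac{|X^{\mathrm{eq}}|}{|X|}\sum_{k=1}^{L}\binom{k+1}{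2}[\alpha]_{0,k}.$$
   Context: $(X,\alpha)$ is $E$-bound if every $\alpha$-cycle meets $E$. The $E$-reaching time $e:X\to\mathbb N$ is $e(i)=$ the smallest $k\ge0$ with $\alpha^k(i)\in E$, and $L=\max_{i\in X}e(i)$. The micro-macro system $(X,[0,L],e,\alpha)$ has microstates $X$, macrostates $[0,L]=\{0,1,\dots,L\}$, micro-to-macro map $e$ and dynamics $\alpha$; the entropy of $i$ is $S(i)=\ln|e^{ -1}(e(i))|$. $X^{\mathrm{eq}}$ is the set of microstates in macrostates of maximal size and $X^{\mathrm{neq}}=X\setminus X^{\mathrm{eq}}$. $D,C,I$ are the sets of $i$ with $S(\alpha i)<S(i)$, $=$, $>$ respectively. For $U,V\subseteq X$, $[\![U,V]\!]=\{i\in U:\alpha(i)\in V\}$, and $[\alpha]_{jk}=|[\![X_j,X_k]\!]|/|X_j|$. A set $F\subseteq X$ is $s$-stable (for an integer $s\ge0$) if for every $i\in F\cap\alpha(X\setminus F)$ we have $\alpha^k i\in F$ for $0\le k\le s$. For $i\in X$, $\mathcal A(i)$ is the largest integer $N\ge0$ with $S(i)<S(\alpha i)<\cdots<S(\alpha^N i)$. -}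

module Defs where

open import Data.Nat as ℕ using (ℕ; zero; suc; _≤_; _<_; _≤?_; _<?_; _≟_; _∸_)
open import Data.Fin using (Fin)
open import Data.Fin.Subset using (Subset; _∈_; _∉_; ∣_∣; ∁)
open import Data.Fin.Properties using (all?)
open import Data.Vec using (tabulate; lookup)
open import Data.Bool using (Bool; _∧_; if_then_else_)
open import Data.Product using (∃; _×_)
open import Data.List using (List; map; foldr; applyUpTo; allFin)
open import Data.Nat.ListAction using (sum)
open import Data.Integer using (ℤ; +_)
open import Data.Rational using (ℚ; _/_; 0ℚ; 1ℚ) renaming (_+_ to _+ℚ_)
open import Relation.Nullary using (does)
open import Relation.Binary.PropositionalEquality using (_≡_)

_^[_] : ∀ {A : Set} → (A → A) → ℕ → A → A
(f ^[ zero ]) x = x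
(f ^[ suc k ]) x = f ((f ^[ k ]) x)

EBound : ∀ {n} → (Fin n → Fin n) → Subset n → Set
EBound α E = ∀ i → ∃ λ k → (α ^[ k ]) i ∈ E

IsReachingTime : ∀ {n} → (Fin n → Fin n) → Subset n → (Fin n → ℕ) → Set
IsReachingTime α E e =
  ∀ i → ((α ^[ e i ]) i ∈ E) × (∀ k → k < e i → (α ^[ k ]) i ∉ E)

IsMaximum : ∀ {n} → (Fin n → ℕ) → ℕ → Set
IsMaximum e L = (∀ i → e i ≤ L) × (∃ λ i → e i ≡ L)

-- macrostate X_k = e⁻¹(k)   (empty for k > L, in particular X_{L+1} = ∅)
Mac : ∀ {n} → (Fin n → ℕ) → ℕ → Subset n
Mac e k = tabulate λ i → does (e i ≟ k)

⟦_,_,_⟧ : ∀ {n} → (Fin n → Fin n) → Subset n → Subset n → Subset n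
⟦ α , U , V ⟧ = tabulate λ i → lookup U i ∧ lookup V (α i)

-- W i = |e⁻¹(e i)|, so that the entropy is S i = ln (W i).
-- Since ln is strictly increasing, S j < S i  iff  W j < W i.
W : ∀ {n} → (Fin n → ℕ) → Fin n → ℕ
W e i = ∣ Mac e (e i) ∣

Xeq : ∀ {n} → (Fin n → ℕ) → Subset n
Xeq e = tabulate λ i → does (all? λ j → W e j ≤? W e i)

Xneq : ∀ {n} → (Fin n → ℕ) → Subset n
Xneq e = ∁ (Xeq e)

Dset : ∀ {n} → (Fin n → Fin n) → (Fin n → ℕ) → Subset n
Dset α e = tabulate λ i → does (W e (α i) <? W e i)

Cset : ∀ {n} → (Fin n → Fin n) → (Fin n → ℕ) → Subset n
Cset α e = tabulate λ i → does (W e (α i) ≟ W e i)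

Iset : ∀ {n} → (Fin n → Fin n) → (Fin n → ℕ) → Subset n
Iset α e = tabulate λ i → does (W e i <? W e (α i))

Stable : ∀ {n} → (Fin n → Fin n) → Subset n → ℕ → Set
Stable α F s =
  ∀ i → i ∈ F → (∃ λ j → (j ∉ F) × (α j ≡ i)) →
  ∀ k → k ≤ s → (α ^[ k ]) i ∈ F

-- rational a / b  (convention: 0 when b = 0; never used with b = 0 below
-- except possibly trivially)
_⊘_ : ℤ → ℕ → ℚ
a ⊘ zero = 0ℚ
a ⊘ suc b = a / suc b

Tr : ∀ {n} → (Fin n → Fin n) → (Fin n → ℕ) → ℕ → ℕ → ℚ
Tr α e j k = (+ ∣ ⟦ α , Mac e j , Mac e k ⟧ ∣) ⊘ ∣ Mac e j ∣

δ : ℕ → ℕ → ℚ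
δ j k = if does (j ≟ k) then 1ℚ else 0ℚ

range : ℕ → ℕ → List ℕ
range k L = applyUpTo (k ℕ.+_) (suc L ∸ k)

Σℕ : ℕ → ℕ → (ℕ → ℕ) → ℕ
Σℕ k L f = sum (map f (range k L))

Σℚ : ℕ → ℕ → (ℕ → ℚ) → ℚ
Σℚ k L f = foldr _+ℚ_ 0ℚ (map f (range k L))

Chain : ∀ {n} → (Fin n → Fin n) → (Fin n → ℕ) → Fin n → ℕ → Set
Chain α e i N = ∀ m → m < N → W e ((α ^[ m ]) i) < W e ((α ^[ suc m ]) i)

IsArrowLength : ∀ {n} → (Fin n → Fin n) → (Fin n → ℕ) → (Fin n → ℕ) → Set
IsArrowLength α e A = ∀ i → Chain α e i (A i) × (∀ N → Chain α e i N → N ≤ A i)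

mean : ∀ {n} → (Fin n → ℕ) → ℚ
mean {n} f = (+ sum (map f (allFin n))) ⊘ n

-- Outside E the reaching time drops by one at each step, so α maps X_{k+1} into X_k, and the rest
-- of α⁻¹(X_k) is ⟦E, X_k⟧; since α is a bijection, |X_k| = |⟦E, X_k⟧| + |X_{k+1}|. Hence the
-- macrostate sizes decrease with k, E = X_0 is a largest macrostate, and entropy cannot drop
-- outside E. If every level k ≤ L is entered from E, the decrease is strict: entropy then rises
-- strictly along an orbit until it hits E, so the arrow of time of i is exactly e(i), whose mean is
-- Σ k |X_k| / |X|. Summation by parts against |X_k| − |X_{k+1}| = |⟦E, X_k⟧| gives the binomial form.

module Submission where

open import Defs
import Algebra.Properties.Semiring.Sum as SemiringSum
open import Data.Bool using (Bool; true; false; not; _∧_; T; if_then_else_)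
open import Data.Bool.Properties using (T-≡; T-∧)
open import Data.Empty using (⊥-elim)
open import Data.Fin using (Fin; zero; suc)
open import Data.Fin.Properties using (all?)
open import Data.Fin.Subset using (Subset; _∈_; _∉_; _⊆_; ∣_∣; ∁; ⊥)
open import Data.Fin.Subset.Properties
  using (⊆-antisym; ⊥⊆; _∈?_; x∈∁p⇒x∉p; x∉p⇒x∈∁p; x∈p⇒∣p-x∣<∣p∣; ∣⊥∣≡0)
open import Data.Integer using (+_; _⊖_) renaming (_-_ to _-ℤ_; _*_ to _*ℤ_; _+_ to _+ℤ_)
import Data.Integer.Properties as ℤ
open import Data.List as List using ([]; _∷_; [_]; applyUpTo; map; foldr; allFin)
open import Data.List.Properties using (applyUpTo-∷ʳ; map-applyUpTo; map-tabulate; map-cong)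
open import Data.Nat
  using (ℕ; zero; suc; NonZero; _+_; _*_; _∸_; _≤_; _<_; z≤n; s≤s; s≤s⁻¹; _≟_; _≤?_; _<?_)
open import Data.Nat using () renaming (_*_ to _*ℕ_)
open import Data.Nat.Combinatorics using (_C_; nC1≡n; nCk+nC[k+1]≡[n+1]C[k+1])
open import Data.Nat.ListAction using (sum)
open import Data.Nat.ListAction.Properties using (sum-++)
open import Data.Nat.Properties
open import Data.Nat.Tactic.RingSolver using (solve-∀)
open import Data.Product using (∃; _×_; _,_; proj₁; proj₂)
open import Data.Rational using (0ℚ; 1ℚ; fromℚᵘ) renaming (_*_ to _*ℚ_; _+_ to _+ℚ_)
import Data.Rational.Properties as ℚ
open import Data.Rational.Unnormalised as ℚᵘ using (mkℚᵘ; *≡*)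
import Data.Rational.Unnormalised.Properties as ℚᵘ
open import Data.Sum using (inj₁; inj₂)
open import Data.Vec using ([]; _∷_; lookup; tabulate)
open import Data.Vec.Properties using (lookup∘tabulate; lookup-map; []=⇒lookup; lookup⇒[]=)
open import Function using (_∘_; id; Equivalence)
open import Function.Bundles using (mk⤖)
open import Function.Definitions using (Bijective)
open import Function.Properties.Bijection using (⤖⇒↔)
open import Relation.Binary.PropositionalEquality
  using (_≡_; _≢_; refl; sym; trans; cong; cong₂; subst; module ≡-Reasoning)
open import Relation.Nullary using (does; ¬_; yes; no)
open import Relation.Nullary.Decidable using (dec-true; dec-false; decidable-stable)
open import Relation.Unary using (Decidable)

open ≡-Reasoning
open SemiringSum +-*-semiring
  using (sum-cong-≗; sum-replicate-zero; ∑-distrib-+; sum-permute; *-distribʳ-sum)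
  renaming (sum to ∑)

-- Finite sums and cardinalities

indicator : Bool → ℕ
indicator true  = 1
indicator false = 0

indicator-∧-not : ∀ x y → indicator (x ∧ y) + indicator (x ∧ not y) ≡ indicator x
indicator-∧-not true  true  = refl
indicator-∧-not true  false = refl
indicator-∧-not false _     = refl

indicator-not-∧ : ∀ x y → indicator (x ∧ y) + indicator (not x ∧ y) ≡ indicator y
indicator-not-∧ true  y     = +-identityʳ (indicator y)
indicator-not-∧ false y     = refl

∑-bijection : ∀ {n} {α : Fin n → Fin n} → Bijective _≡_ _≡_ α → (f : Fin n → ℕ) → ∑ (f ∘ α) ≡ ∑ f
∑-bijection bij f = sym (sum-permute f (⤖⇒↔ (mk⤖ bij)))

∑-+-≗ : ∀ {n} {f g h : Fin n → ℕ} → (∀ i → f i + g i ≡ h i) → ∑ f + ∑ g ≡ ∑ h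
∑-+-≗ {f = f} {g} f+g≗h = trans (sym (∑-distrib-+ f g)) (sum-cong-≗ f+g≗h)

sum-tabulate : ∀ {n} (f : Fin n → ℕ) → sum (List.tabulate f) ≡ ∑ f
sum-tabulate {zero}  f = refl
sum-tabulate {suc n} f = cong (_+_ (f zero)) (sum-tabulate (f ∘ suc))

∣p∣≡∑ : ∀ {n} (p : Subset n) → ∣ p ∣ ≡ ∑ (indicator ∘ lookup p)
∣p∣≡∑ []          = refl
∣p∣≡∑ (true ∷ p)  = cong suc (∣p∣≡∑ p)
∣p∣≡∑ (false ∷ p) = ∣p∣≡∑ p

∣tabulate∣≡∑ : ∀ {n} (f : Fin n → Bool) → ∣ tabulate f ∣ ≡ ∑ (indicator ∘ f)
∣tabulate∣≡∑ f = trans (∣p∣≡∑ (tabulate f)) (sum-cong-≗ (cong indicator ∘ lookup∘tabulate f))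

∈⇒∣∣>0 : ∀ {n} {p : Subset n} {i} → i ∈ p → 0 < ∣ p ∣
∈⇒∣∣>0 i∈p = ≤-<-trans z≤n (x∈p⇒∣p-x∣<∣p∣ i∈p)

∈⇒T : ∀ {n} {p : Subset n} {i} → i ∈ p → T (lookup p i)
∈⇒T i∈p = Equivalence.from T-≡ ([]=⇒lookup i∈p)

T⇒∈ : ∀ {n} {p : Subset n} {i} → T (lookup p i) → i ∈ p
T⇒∈ {p = p} {i} t = lookup⇒[]= i p (Equivalence.to T-≡ t)

∈-tabulate⁺ : ∀ {n} {f : Fin n → Bool} {i} → T (f i) → i ∈ tabulate f
∈-tabulate⁺ {f = f} {i} = T⇒∈ ∘ subst T (sym (lookup∘tabulate f i))

∈-tabulate⁻ : ∀ {n} {f : Fin n → Bool} {i} → i ∈ tabulate f → T (f i)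
∈-tabulate⁻ {f = f} {i} = subst T (lookup∘tabulate f i) ∘ ∈⇒T

∈-tabulate-does⁺ : ∀ {n} {P : Fin n → Set} (P? : Decidable P) {i} → P i → i ∈ tabulate (λ j → does (P? j))
∈-tabulate-does⁺ P? {i} p = ∈-tabulate⁺ (Equivalence.from T-≡ (dec-true (P? i) p))

∈-tabulate-does⁻ : ∀ {n} {P : Fin n → Set} (P? : Decidable P) {i} → i ∈ tabulate (λ j → does (P? j)) → P i
∈-tabulate-does⁻ P? {i} i∈ with P? i | ∈-tabulate⁻ {f = λ j → does (P? j)} i∈
... | yes p | _  = p
... | no _  | ()

module _ {n} (e : Fin n → ℕ) where

  ∈Mac⁺ : ∀ {i k} → e i ≡ k → i ∈ Mac e k
  ∈Mac⁺ {k = k} = ∈-tabulate-does⁺ (λ j → e j ≟ k)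

  ∈Mac⁻ : ∀ {i k} → i ∈ Mac e k → e i ≡ k
  ∈Mac⁻ {k = k} = ∈-tabulate-does⁻ (λ j → e j ≟ k)

  ∈Xeq⁺ : ∀ {i} → (∀ j → W e j ≤ W e i) → i ∈ Xeq e
  ∈Xeq⁺ = ∈-tabulate-does⁺ (λ i → all? (λ j → W e j ≤? W e i))

  ∈Xeq⁻ : ∀ {i} → i ∈ Xeq e → ∀ j → W e j ≤ W e i
  ∈Xeq⁻ = ∈-tabulate-does⁻ (λ i → all? (λ j → W e j ≤? W e i))

module _ {n} (α : Fin n → Fin n) where

  ∈⟦,⟧⁺ : ∀ {U V i} → i ∈ U → α i ∈ V → i ∈ ⟦ α , U , V ⟧
  ∈⟦,⟧⁺ i∈U αi∈V = ∈-tabulate⁺ (Equivalence.from T-∧ (∈⇒T i∈U , ∈⇒T αi∈V))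

  ∈⟦,⟧⁻ : ∀ {U V i} → i ∈ ⟦ α , U , V ⟧ → i ∈ U × α i ∈ V
  ∈⟦,⟧⁻ i∈ = let (t , u) = Equivalence.to T-∧ (∈-tabulate⁻ i∈) in T⇒∈ t , T⇒∈ u

  ∣⟦,⟧∣≡∑ : ∀ U V → ∣ ⟦ α , U , V ⟧ ∣ ≡ ∑ (λ i → indicator (lookup U i ∧ lookup V (α i)))
  ∣⟦,⟧∣≡∑ U V = ∣tabulate∣≡∑ (λ i → lookup U i ∧ lookup V (α i))

  ∣⟦U,V⟧∣+∣⟦U,∁V⟧∣≡∣U∣ : ∀ U V → ∣ ⟦ α , U , V ⟧ ∣ + ∣ ⟦ α , U , ∁ V ⟧ ∣ ≡ ∣ U ∣
  ∣⟦U,V⟧∣+∣⟦U,∁V⟧∣≡∣U∣ U V = begin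
    ∣ ⟦ α , U , V ⟧ ∣ + ∣ ⟦ α , U , ∁ V ⟧ ∣  ≡⟨ cong₂ _+_ (∣⟦,⟧∣≡∑ U V) (∣⟦,⟧∣≡∑ U (∁ V)) ⟩
    _                                      ≡⟨ ∑-+-≗ split ⟩
    ∑ (indicator ∘ lookup U)               ≡⟨ ∣p∣≡∑ U ⟨
    ∣ U ∣                                  ∎
    where
    split : ∀ i → indicator (lookup U i ∧ lookup V (α i)) + indicator (lookup U i ∧ lookup (∁ V) (α i))
                ≡ indicator (lookup U i)
    split i rewrite lookup-map (α i) not V = indicator-∧-not (lookup U i) (lookup V (α i))

  ∣⟦U,V⟧∣+∣⟦∁U,V⟧∣≡∣V∣ : Bijective _≡_ _≡_ α → ∀ U V → ∣ ⟦ α , U , V ⟧ ∣ + ∣ ⟦ α , ∁ U , V ⟧ ∣ ≡ ∣ V ∣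
  ∣⟦U,V⟧∣+∣⟦∁U,V⟧∣≡∣V∣ bij U V = begin
    ∣ ⟦ α , U , V ⟧ ∣ + ∣ ⟦ α , ∁ U , V ⟧ ∣  ≡⟨ cong₂ _+_ (∣⟦,⟧∣≡∑ U V) (∣⟦,⟧∣≡∑ (∁ U) V) ⟩
    _                                      ≡⟨ ∑-+-≗ split ⟩
    ∑ (indicator ∘ lookup V ∘ α)           ≡⟨ ∑-bijection bij (indicator ∘ lookup V) ⟩
    ∑ (indicator ∘ lookup V)               ≡⟨ ∣p∣≡∑ V ⟨
    ∣ V ∣                                  ∎
    where
    split : ∀ i → indicator (lookup U i ∧ lookup V (α i)) + indicator (lookup (∁ U) i ∧ lookup V (α i))
                ≡ indicator (lookup V (α i))
    split i rewrite lookup-map i not U = indicator-not-∧ (lookup U i) (lookup V (α i))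

-- Sums over initial segments of ℕ

sumBelow : ℕ → (ℕ → ℕ) → ℕ
sumBelow M f = sum (applyUpTo f M)

sumBelow-suc : ∀ M f → sumBelow (suc M) f ≡ sumBelow M f + f M
sumBelow-suc M f = begin
  sum (applyUpTo f (suc M))            ≡⟨ cong sum (applyUpTo-∷ʳ f M) ⟨
  sum (applyUpTo f M List.++ [ f M ])  ≡⟨ sum-++ (applyUpTo f M) [ f M ] ⟩
  sumBelow M f + (f M + 0)             ≡⟨ cong (_+_ (sumBelow M f)) (+-identityʳ (f M)) ⟩
  sumBelow M f + f M                   ∎

sumBelow-cong : ∀ M {f g} → (∀ k → f k ≡ g k) → sumBelow M f ≡ sumBelow M g
sumBelow-cong zero    f≗g = refl
sumBelow-cong (suc M) f≗g = cong₂ _+_ (f≗g 0) (sumBelow-cong M (f≗g ∘ suc))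

Σℕ≡sumBelow : ∀ k L f → Σℕ k L f ≡ sumBelow (suc L ∸ k) (f ∘ _+_ k)
Σℕ≡sumBelow k L f = cong sum (map-applyUpTo (_+_ k) f (suc L ∸ k))

sumBelow-zero : ∀ M → sumBelow M (λ _ → 0) ≡ 0
sumBelow-zero zero    = refl
sumBelow-zero (suc M) = sumBelow-zero M

∑-sumBelow-comm : ∀ {n} M (h : Fin n → ℕ → ℕ) →
                  ∑ (λ i → sumBelow M (h i)) ≡ sumBelow M (λ k → ∑ (λ i → h i k))
∑-sumBelow-comm {n} zero    h = sum-replicate-zero n
∑-sumBelow-comm     (suc M) h = begin
  ∑ (λ i → h i 0 + sumBelow M (h i ∘ suc))
    ≡⟨ ∑-distrib-+ (λ i → h i 0) (λ i → sumBelow M (h i ∘ suc)) ⟩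
  ∑ (λ i → h i 0) + ∑ (λ i → sumBelow M (h i ∘ suc))
    ≡⟨ cong (_+_ (∑ (λ i → h i 0))) (∑-sumBelow-comm M (λ i → h i ∘ suc)) ⟩
  ∑ (λ i → h i 0) + sumBelow M (λ k → ∑ (λ i → h i (suc k)))
    ∎

𝟙[_≡_] : ℕ → ℕ → ℕ
𝟙[ a ≡ b ] = indicator (does (a ≟ b))

sumBelow-pick : ∀ M (g : ℕ → ℕ) {v} → v < M → sumBelow M (λ k → 𝟙[ v ≡ k ] * g k) ≡ g v
sumBelow-pick (suc M) g {zero}  _         = trans (cong₂ _+_ (+-identityʳ (g 0)) (sumBelow-zero M)) (+-identityʳ (g 0))
sumBelow-pick (suc M) g {suc v} (s≤s v<M) = sumBelow-pick M (g ∘ suc) v<M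

∑-fibres : ∀ {n} (f : Fin n → ℕ) (g : ℕ → ℕ) M → (∀ i → f i < M) →
           ∑ (g ∘ f) ≡ sumBelow M (λ k → g k * ∣ Mac f k ∣)
∑-fibres f g M f<M = begin
  ∑ (g ∘ f)
    ≡⟨ sum-cong-≗ (λ i → sumBelow-pick M g (f<M i)) ⟨
  ∑ (λ i → sumBelow M (λ k → 𝟙[ f i ≡ k ] * g k))
    ≡⟨ ∑-sumBelow-comm M (λ i k → 𝟙[ f i ≡ k ] * g k) ⟩
  sumBelow M (λ k → ∑ (λ i → 𝟙[ f i ≡ k ] * g k))
    ≡⟨ sumBelow-cong M fibre ⟩
  sumBelow M (λ k → g k * ∣ Mac f k ∣)
    ∎
  where
  fibre : ∀ k → ∑ (λ i → 𝟙[ f i ≡ k ] * g k) ≡ g k * ∣ Mac f k ∣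
  fibre k = begin
    ∑ (λ i → 𝟙[ f i ≡ k ] * g k)  ≡⟨ *-distribʳ-sum (g k) (λ i → 𝟙[ f i ≡ k ]) ⟨
    ∑ (λ i → 𝟙[ f i ≡ k ]) * g k  ≡⟨ cong (_* g k) (∣tabulate∣≡∑ (λ i → does (f i ≟ k))) ⟨
    ∣ Mac f k ∣ * g k             ≡⟨ *-comm (∣ Mac f k ∣) (g k) ⟩
    g k * ∣ Mac f k ∣             ∎

telescope : ∀ (x c : ℕ → ℕ) → (∀ k → x k ≡ c k + x (suc k)) →
            ∀ k M → x k ≡ sumBelow M (c ∘ _+_ k) + x (k + M)
telescope x c step k zero    = cong x (sym (+-identityʳ k))
telescope x c step k (suc M) = begin
  x k                                ≡⟨ telescope x c step k M ⟩
  S + x (k + M)                      ≡⟨ cong (_+_ S) (step (k + M)) ⟩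
  S + (c (k + M) + x (suc (k + M)))  ≡⟨ +-assoc S (c (k + M)) (x (suc (k + M))) ⟨
  S + c (k + M) + x (suc (k + M))    ≡⟨ cong₂ _+_ (sumBelow-suc M (c ∘ _+_ k)) (cong x (+-suc k M)) ⟨
  sumBelow (suc M) (c ∘ _+_ k) + x (k + suc M) ∎
  where
  S : ℕ
  S = sumBelow M (c ∘ _+_ k)

sumBelow-by-parts : ∀ (x c : ℕ → ℕ) → (∀ k → x k ≡ c k + x (suc k)) → ∀ M →
                    sumBelow M (λ k → k * x k) ≡ sumBelow M (λ k → (suc k C 2) * c k) + (M C 2) * x M
sumBelow-by-parts x c step zero    = refl
sumBelow-by-parts x c step (suc M) = begin
  sumBelow (suc M) (λ k → k * x k)             ≡⟨ sumBelow-suc M (λ k → k * x k) ⟩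
  sumBelow M (λ k → k * x k) + M * x M         ≡⟨ cong (_+ M * x M) (sumBelow-by-parts x c step M) ⟩
  S + (M C 2) * x M + M * x M                  ≡⟨ regroup S (M C 2) M (x M) ⟩
  S + (M + M C 2) * x M                        ≡⟨ cong₂ (λ m y → S + m * y) pascal (step M) ⟩
  S + (suc M C 2) * (c M + x (suc M))          ≡⟨ distribute S (suc M C 2) (c M) (x (suc M)) ⟩
  S + (suc M C 2) * c M + (suc M C 2) * x (suc M)
    ≡⟨ cong (_+ (suc M C 2) * x (suc M)) (sumBelow-suc M (λ k → (suc k C 2) * c k)) ⟨
  sumBelow (suc M) (λ k → (suc k C 2) * c k) + (suc M C 2) * x (suc M) ∎
  where
  S : ℕ
  S = sumBelow M (λ k → (suc k C 2) * c k)
  pascal : M + M C 2 ≡ suc M C 2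
  pascal = trans (cong (_+ M C 2) (sym (nC1≡n M))) (nCk+nC[k+1]≡[n+1]C[k+1] M 1)
  regroup : ∀ s b m y → s + b * y + m * y ≡ s + (m + b) * y
  regroup = solve-∀
  distribute : ∀ s b u y → s + b * (u + y) ≡ s + b * u + b * y
  distribute = solve-∀

-- Fractions

-- For a positive denominator, (+ a) ⊘ suc d is definitionally fromℚᵘ (mkℚᵘ (+ a) d), so
-- identities between fractions are proved by cross-multiplication in ℚᵘ.
fromℚᵘ-homo-+ : ∀ p q → fromℚᵘ (p ℚᵘ.+ q) ≡ fromℚᵘ p +ℚ fromℚᵘ q
fromℚᵘ-homo-+ p q = ℚ.toℚᵘ-injective (ℚᵘ.≃-trans (ℚ.toℚᵘ-fromℚᵘ (p ℚᵘ.+ q)) (ℚᵘ.≃-sym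
  (ℚᵘ.≃-trans (ℚ.toℚᵘ-homo-+ (fromℚᵘ p) (fromℚᵘ q)) (ℚᵘ.+-cong (ℚ.toℚᵘ-fromℚᵘ p) (ℚ.toℚᵘ-fromℚᵘ q)))))

fromℚᵘ-homo-* : ∀ p q → fromℚᵘ (p ℚᵘ.* q) ≡ fromℚᵘ p *ℚ fromℚᵘ q
fromℚᵘ-homo-* p q = ℚ.toℚᵘ-injective (ℚᵘ.≃-trans (ℚ.toℚᵘ-fromℚᵘ (p ℚᵘ.* q)) (ℚᵘ.≃-sym
  (ℚᵘ.≃-trans (ℚ.toℚᵘ-homo-* (fromℚᵘ p) (fromℚᵘ q)) (ℚᵘ.*-cong (ℚ.toℚᵘ-fromℚᵘ p) (ℚ.toℚᵘ-fromℚᵘ q)))))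

⊘-cong : ∀ a b m m′ .{{_ : NonZero m}} .{{_ : NonZero m′}} → a * m′ ≡ b * m → (+ a) ⊘ m ≡ (+ b) ⊘ m′
⊘-cong a b (suc d) (suc d′) eq = ℚ.fromℚᵘ-cong {mkℚᵘ (+ a) d} {mkℚᵘ (+ b) d′} (*≡* (begin
  + a *ℤ + suc d′  ≡⟨ ℤ.pos-* a (suc d′) ⟨
  + (a * suc d′)   ≡⟨ cong +_ eq ⟩
  + (b * suc d)    ≡⟨ ℤ.pos-* b (suc d) ⟩
  + b *ℤ + suc d   ∎))

⊘-homo-+ : ∀ a b d d′ → (+ a) ⊘ suc d +ℚ (+ b) ⊘ suc d′ ≡ (+ (a * suc d′ + b * suc d)) ⊘ (suc d * suc d′)
⊘-homo-+ a b d d′ = begin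
  (+ a) ⊘ suc d +ℚ (+ b) ⊘ suc d′                        ≡⟨ fromℚᵘ-homo-+ (mkℚᵘ (+ a) d) (mkℚᵘ (+ b) d′) ⟨
  (+ a *ℤ + suc d′ +ℤ + b *ℤ + suc d) ⊘ (suc d * suc d′)  ≡⟨ cong (_⊘ (suc d * suc d′)) numerator ⟩
  (+ (a * suc d′ + b * suc d)) ⊘ (suc d * suc d′)         ∎
  where
  numerator : + a *ℤ + suc d′ +ℤ + b *ℤ + suc d ≡ + (a * suc d′ + b * suc d)
  numerator = sym (trans (ℤ.pos-+ (a * suc d′) (b * suc d))
                         (cong₂ _+ℤ_ (ℤ.pos-* a (suc d′)) (ℤ.pos-* b (suc d))))

⊘-homo-* : ∀ a b d d′ → (+ a) ⊘ suc d *ℚ (+ b) ⊘ suc d′ ≡ (+ (a * b)) ⊘ (suc d * suc d′)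
⊘-homo-* a b d d′ = begin
  (+ a) ⊘ suc d *ℚ (+ b) ⊘ suc d′        ≡⟨ fromℚᵘ-homo-* (mkℚᵘ (+ a) d) (mkℚᵘ (+ b) d′) ⟨
  (+ a *ℤ + b) ⊘ (suc d * suc d′)        ≡⟨ cong (_⊘ (suc d * suc d′)) (ℤ.pos-* a b) ⟨
  (+ (a * b)) ⊘ (suc d * suc d′)         ∎

⊘-+-same : ∀ a b d → (+ a) ⊘ suc d +ℚ (+ b) ⊘ suc d ≡ (+ (a + b)) ⊘ suc d
⊘-+-same a b d =
  trans (⊘-homo-+ a b d d) (⊘-cong (a * suc d + b * suc d) (a + b) (suc d * suc d) (suc d) (identity a b (suc d)))
  where
  identity : ∀ a b s → (a * s + b * s) * s ≡ (a + b) * (s * s)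
  identity = solve-∀

integer-*-⊘ : ∀ a b d → (+ a) ⊘ 1 *ℚ (+ b) ⊘ suc d ≡ (+ (a * b)) ⊘ suc d
integer-*-⊘ a b d =
  trans (⊘-homo-* a b 0 d) (⊘-cong (a * b) (a * b) (1 * suc d) (suc d) (cong (a * b *_) (sym (+-identityʳ (suc d)))))

⊘-*-cancel : ∀ {m} N T → 0 < m → (+ m) ⊘ N *ℚ (+ T) ⊘ m ≡ (+ T) ⊘ N
⊘-*-cancel {suc d} zero    T _ = ℚ.*-zeroˡ ((+ T) ⊘ suc d)
⊘-*-cancel {suc d} (suc N) T _ =
  trans (⊘-homo-* (suc d) T N d) (⊘-cong (suc d * T) T (suc N * suc d) (suc N) (identity (suc d) T (suc N)))
  where
  identity : ∀ s t r → s * t * r ≡ t * (r * s)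
  identity = solve-∀

n⊘n≡1 : ∀ {m} → 0 < m → (+ m) ⊘ m ≡ 1ℚ
n⊘n≡1 {suc b} _ = ⊘-cong (suc b) 1 (suc b) 1 (*-comm (suc b) 1)

0⊘n≡0 : ∀ m → (+ 0) ⊘ m ≡ 0ℚ
0⊘n≡0 zero    = refl
0⊘n≡0 (suc m) = ℚ.0/n≡0 (suc m)

foldr-+ℚ-⊘ : ∀ {m} (a b : ℕ → ℕ) ks → 0 < m →
             foldr _+ℚ_ 0ℚ (map (λ k → (+ a k) ⊘ 1 *ℚ (+ b k) ⊘ m) ks)
             ≡ (+ sum (map (λ k → a k * b k) ks)) ⊘ m
foldr-+ℚ-⊘ {m}     a b []       _   = sym (0⊘n≡0 m)
foldr-+ℚ-⊘ {suc d} a b (k ∷ ks) m>0 = begin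
  (+ a k) ⊘ 1 *ℚ (+ b k) ⊘ suc d +ℚ foldr _+ℚ_ 0ℚ (map (λ k → (+ a k) ⊘ 1 *ℚ (+ b k) ⊘ suc d) ks)
    ≡⟨ cong₂ _+ℚ_ (integer-*-⊘ (a k) (b k) d) (foldr-+ℚ-⊘ a b ks m>0) ⟩
  (+ (a k * b k)) ⊘ suc d +ℚ (+ sum (map (λ k → a k * b k) ks)) ⊘ suc d
    ≡⟨ ⊘-+-same (a k * b k) _ d ⟩
  (+ sum (map (λ k → a k * b k) (k ∷ ks))) ⊘ suc d ∎

m≡o+n⇒+o≡+m-+n : ∀ {m n o} → m ≡ o + n → + o ≡ + m -ℤ + n
m≡o+n⇒+o≡+m-+n {n = n} {o} refl = begin
  + o               ≡⟨ cong +_ (m+n∸n≡m o n) ⟨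
  + (o + n ∸ n)     ≡⟨ ℤ.⊖-≥ (m≤n+m n o) ⟨
  (o + n) ⊖ n       ≡⟨ ℤ.[+m]-[+n]≡m⊖n (o + n) n ⟨
  + (o + n) -ℤ + n  ∎

δ-≡ : ∀ {j k} → j ≡ k → δ j k ≡ 1ℚ
δ-≡ {j} {k} j≡k = cong (if_then 1ℚ else 0ℚ) (dec-true (j ≟ k) j≡k)

δ-≢ : ∀ {j k} → j ≢ k → δ j k ≡ 0ℚ
δ-≢ {j} {k} j≢k = cong (if_then 1ℚ else 0ℚ) (dec-false (j ≟ k) j≢k)

-- Orbits, reaching time and arrow of time

^[]-suc : ∀ {A : Set} (f : A → A) k x → (f ^[ k ]) (f x) ≡ (f ^[ suc k ]) x
^[]-suc f zero    x = refl
^[]-suc f (suc k) x = cong f (^[]-suc f k x)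

^[]-+ : ∀ {A : Set} (f : A → A) r q x → (f ^[ r ]) ((f ^[ q ]) x) ≡ (f ^[ r + q ]) x
^[]-+ f zero    q x = refl
^[]-+ f (suc r) q x = cong f (^[]-+ f r q x)

module _ {n} (α : Fin n → Fin n) (e : Fin n → ℕ) where

  Chain-≤ : ∀ {i M N} → M ≤ N → Chain α e i N → Chain α e i M
  Chain-≤ M≤N chain m m<M = chain m (<-≤-trans m<M M≤N)

  arrowLength-unique : ∀ {A i N} → IsArrowLength α e A → Chain α e i N → ¬ Chain α e i (suc N) → A i ≡ N
  arrowLength-unique {A} {i} {N} isA chain stop =
    ≤-antisym (≮⇒≥ (λ N<Ai → stop (Chain-≤ N<Ai (proj₁ (isA i))))) (proj₂ (isA i) N chain)

module ReachingTime {n} (α : Fin n → Fin n) (E : Subset n) (e : Fin n → ℕ) (reach : IsReachingTime α E e) where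

  e-minimal : ∀ i k → (α ^[ k ]) i ∈ E → e i ≤ k
  e-minimal i k αᵏi∈E = ≮⇒≥ (λ k<ei → proj₂ (reach i) k k<ei αᵏi∈E)

  ∈E⇒e≡0 : ∀ {i} → i ∈ E → e i ≡ 0
  ∈E⇒e≡0 {i} i∈E = n≤0⇒n≡0 (e-minimal i 0 i∈E)

  e≡0⇒∈E : ∀ {i} → e i ≡ 0 → i ∈ E
  e≡0⇒∈E {i} ei≡0 = subst (λ k → (α ^[ k ]) i ∈ E) ei≡0 (proj₁ (reach i))

  e≡suc⇒∉E : ∀ {i k} → e i ≡ suc k → i ∉ E
  e≡suc⇒∉E ei≡ i∈E = 0≢1+n (trans (sym (∈E⇒e≡0 i∈E)) ei≡)

  e-suc : ∀ {i} → i ∉ E → e i ≡ suc (e (α i))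
  e-suc {i} i∉E with e i in ei≡
  ... | zero  = ⊥-elim (i∉E (e≡0⇒∈E ei≡))
  ... | suc p = cong suc (≤-antisym p≤eαi eαi≤p)
    where
    p≤eαi : p ≤ e (α i)
    p≤eαi = s≤s⁻¹ (subst (_≤ suc (e (α i))) ei≡
              (e-minimal i (suc (e (α i))) (subst (_∈ E) (^[]-suc α (e (α i)) i) (proj₁ (reach (α i))))))
    eαi≤p : e (α i) ≤ p
    eαi≤p = e-minimal (α i) p (subst (_∈ E) (sym (^[]-suc α p i))
              (subst (λ k → (α ^[ k ]) i ∈ E) ei≡ (proj₁ (reach i))))

  e-iterate : ∀ m t i → e i ≡ m + t → e ((α ^[ m ]) i) ≡ t
  e-iterate zero    t i ei≡ = ei≡
  e-iterate (suc m) t i ei≡ = suc-injective (trans (sym (e-suc (e≡suc⇒∉E eαᵐi≡))) eαᵐi≡)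
    where
    eαᵐi≡ : e ((α ^[ m ]) i) ≡ suc t
    eαᵐi≡ = e-iterate m (suc t) i (trans ei≡ (sym (+-suc m t)))

  E≡X₀ : E ≡ Mac e 0
  E≡X₀ = ⊆-antisym (∈Mac⁺ e ∘ ∈E⇒e≡0) (e≡0⇒∈E ∘ ∈Mac⁻ e)

  ∈X₁₊ₖ⇒∉E : ∀ {i k} → i ∈ Mac e (suc k) → i ∉ E
  ∈X₁₊ₖ⇒∉E i∈ = e≡suc⇒∉E (∈Mac⁻ e i∈)

  ∈X₁₊ₖ⇒α∈Xₖ : ∀ {i k} → i ∈ Mac e (suc k) → α i ∈ Mac e k
  ∈X₁₊ₖ⇒α∈Xₖ i∈ = ∈Mac⁺ e (suc-injective (trans (sym (e-suc (∈X₁₊ₖ⇒∉E i∈))) (∈Mac⁻ e i∈)))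

  ⟦∁E,Xₖ⟧≡X₁₊ₖ : ∀ k → ⟦ α , ∁ E , Mac e k ⟧ ≡ Mac e (suc k)
  ⟦∁E,Xₖ⟧≡X₁₊ₖ k = ⊆-antisym forward backward
    where
    forward : ⟦ α , ∁ E , Mac e k ⟧ ⊆ Mac e (suc k)
    forward i∈ = let (i∉E , αi∈Xₖ) = ∈⟦,⟧⁻ α i∈ in
      ∈Mac⁺ e (trans (e-suc (x∈∁p⇒x∉p i∉E)) (cong suc (∈Mac⁻ e αi∈Xₖ)))
    backward : Mac e (suc k) ⊆ ⟦ α , ∁ E , Mac e k ⟧
    backward i∈ = ∈⟦,⟧⁺ α (x∉p⇒x∈∁p (∈X₁₊ₖ⇒∉E i∈)) (∈X₁₊ₖ⇒α∈Xₖ i∈)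

  ⟦X₁₊ⱼ,Xⱼ⟧≡X₁₊ⱼ : ∀ j → ⟦ α , Mac e (suc j) , Mac e j ⟧ ≡ Mac e (suc j)
  ⟦X₁₊ⱼ,Xⱼ⟧≡X₁₊ⱼ j =
    ⊆-antisym (λ i∈ → proj₁ (∈⟦,⟧⁻ α {V = Mac e j} i∈)) (λ i∈ → ∈⟦,⟧⁺ α i∈ (∈X₁₊ₖ⇒α∈Xₖ i∈))

  ⟦X₁₊ⱼ,Xₖ⟧≡⊥ : ∀ {j k} → j ≢ k → ⟦ α , Mac e (suc j) , Mac e k ⟧ ≡ ⊥
  ⟦X₁₊ⱼ,Xₖ⟧≡⊥ j≢k = ⊆-antisym (λ i∈ → let (i∈X₁₊ⱼ , αi∈Xₖ) = ∈⟦,⟧⁻ α i∈ in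
    ⊥-elim (j≢k (trans (sym (∈Mac⁻ e (∈X₁₊ₖ⇒α∈Xₖ i∈X₁₊ⱼ))) (∈Mac⁻ e αi∈Xₖ)))) ⊥⊆

  first-hit-entered-from-outside : ∀ {i j} → j ∉ E → α j ≡ i →
                                   ∃ λ z → z ∉ E × α z ≡ (α ^[ e i ]) i
  first-hit-entered-from-outside {i} {j} j∉E αj≡i = entry (e i) refl
    where
    entry : ∀ q → e i ≡ q → ∃ λ z → z ∉ E × α z ≡ (α ^[ q ]) i
    entry zero    _   = j , j∉E , αj≡i
    entry (suc p) ei≡ = (α ^[ p ]) i , e≡suc⇒∉E (e-iterate p 1 i (trans ei≡ (+-comm 1 p))) , refl

-- Macrostates and entropy

module Macrostates {n} (α : Fin n → Fin n) (E : Subset n) (e : Fin n → ℕ) (reach : IsReachingTime α E e)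
                   (bij : Bijective _≡_ _≡_ α) (L : ℕ) (maximum : IsMaximum e L) where

  open ReachingTime α E e reach

  X : ℕ → ℕ
  X k = ∣ Mac e k ∣

  c : ℕ → ℕ
  c k = ∣ ⟦ α , E , Mac e k ⟧ ∣

  X-step : ∀ k → X k ≡ c k + X (suc k)
  X-step k = begin
    X k                              ≡⟨ ∣⟦U,V⟧∣+∣⟦∁U,V⟧∣≡∣V∣ α bij E (Mac e k) ⟨
    c k + ∣ ⟦ α , ∁ E , Mac e k ⟧ ∣  ≡⟨ cong (λ p → c k + ∣ p ∣) (⟦∁E,Xₖ⟧≡X₁₊ₖ k) ⟩
    c k + X (suc k)                  ∎

  X-antitone : ∀ {j k} → j ≤ k → X k ≤ X j
  X-antitone {k = zero}  z≤n = ≤-refl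
  X-antitone {j} {suc k} j≤1+k with m≤n⇒m<n∨m≡n j≤1+k
  ... | inj₁ j<1+k = ≤-trans (subst (X (suc k) ≤_) (sym (X-step k)) (m≤n+m (X (suc k)) (c k)))
                             (X-antitone (s≤s⁻¹ j<1+k))
  ... | inj₂ refl  = ≤-refl

  X≤∣E∣ : ∀ k → X k ≤ ∣ E ∣
  X≤∣E∣ k = subst (X k ≤_) (cong ∣_∣ (sym E≡X₀)) (X-antitone z≤n)

  X-vanishes : ∀ {k} → L < k → X k ≡ 0
  X-vanishes {k} L<k = trans (cong ∣_∣ Xₖ≡⊥) (∣⊥∣≡0 n)
    where
    Xₖ≡⊥ : Mac e k ≡ ⊥
    Xₖ≡⊥ = ⊆-antisym (λ {i} i∈ → ⊥-elim (<⇒≱ L<k (subst (_≤ L) (∈Mac⁻ e i∈) (proj₁ maximum i)))) ⊥⊆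

  X>0 : ∀ {k} → k ≤ L → 0 < X k
  X>0 {k} k≤L = let (i₀ , eᵢ₀≡L) = proj₂ maximum in
    ∈⇒∣∣>0 (∈Mac⁺ e (e-iterate (L ∸ k) k i₀ (trans eᵢ₀≡L (sym (m∸n+n≡m k≤L)))))

  X≡Σc : ∀ {k} → k ≤ L → X k ≡ Σℕ k L c
  X≡Σc {k} k≤L = begin
    X k                        ≡⟨ telescope X c X-step k (suc L ∸ k) ⟩
    S + X (k + (suc L ∸ k))    ≡⟨ cong (_+_ S) (X-vanishes L<end) ⟩
    S + 0                      ≡⟨ +-identityʳ S ⟩
    S                          ≡⟨ Σℕ≡sumBelow k L c ⟨
    Σℕ k L c                   ∎
    where
    S : ℕ
    S = sumBelow (suc L ∸ k) (c ∘ _+_ k)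
    L<end : L < k + (suc L ∸ k)
    L<end = subst (L <_) (sym (m+[n∸m]≡n (m≤n⇒m≤1+n k≤L))) ≤-refl

  W-∈E : ∀ {i} → i ∈ E → W e i ≡ ∣ E ∣
  W-∈E i∈E = trans (cong X (∈E⇒e≡0 i∈E)) (cong ∣_∣ (sym E≡X₀))

  W-maximal-on-E : ∀ {i} → i ∈ E → ∀ j → W e j ≤ W e i
  W-maximal-on-E i∈E j = subst (W e j ≤_) (sym (W-∈E i∈E)) (X≤∣E∣ (e j))

  E⊆Xeq : E ⊆ Xeq e
  E⊆Xeq = ∈Xeq⁺ e ∘ W-maximal-on-E

  ∈Xneq⇒∉E : ∀ {i} → i ∈ Xneq e → i ∉ E
  ∈Xneq⇒∉E i∈Xneq i∈E = x∈∁p⇒x∉p i∈Xneq (E⊆Xeq i∈E)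

  W-nondecreasing : ∀ {i} → i ∉ E → W e i ≤ W e (α i)
  W-nondecreasing {i} i∉E = subst (λ k → X k ≤ X (e (α i))) (sym (e-suc i∉E)) (X-antitone (n≤1+n _))

  Xeq-downward : ∀ {i j} → e j ≤ e i → i ∈ Xeq e → j ∈ Xeq e
  Xeq-downward ej≤ei i∈Xeq = ∈Xeq⁺ e (λ l → ≤-trans (∈Xeq⁻ e i∈Xeq l) (X-antitone ej≤ei))

  -- Until the orbit of i reaches E its reaching time decreases, which keeps it in Xeq;
  -- from the first hit of E on, the s-stability of E takes over.
  Xeq-stable : ∀ s → Stable α E s → Stable α (Xeq e) s
  Xeq-stable s E-stable i i∈Xeq (j , j∉Xeq , αj≡i) k k≤s with ≤-total k (e i)
  ... | inj₁ k≤ei = Xeq-downward (subst (_≤ e i) (sym eαᵏi≡) (m∸n≤m (e i) k)) i∈Xeq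
    where
    eαᵏi≡ : e ((α ^[ k ]) i) ≡ e i ∸ k
    eαᵏi≡ = e-iterate k (e i ∸ k) i (sym (m+[n∸m]≡n k≤ei))
  ... | inj₂ ei≤k = subst (_∈ Xeq e) landing (E⊆Xeq (E-stable _ (proj₁ (reach i)) entered (k ∸ e i) k∸ei≤s))
    where
    entered : ∃ λ z → z ∉ E × α z ≡ (α ^[ e i ]) i
    entered = first-hit-entered-from-outside (j∉Xeq ∘ E⊆Xeq) αj≡i
    k∸ei≤s : k ∸ e i ≤ s
    k∸ei≤s = ≤-trans (m∸n≤m k (e i)) k≤s
    landing : (α ^[ k ∸ e i ]) ((α ^[ e i ]) i) ≡ (α ^[ k ]) i
    landing = trans (^[]-+ α (k ∸ e i) (e i) i) (cong (λ m → (α ^[ m ]) i) (m∸n+n≡m ei≤k))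

  c≡ΔX : ∀ k → + c k ≡ + X k -ℤ + X (suc k)
  c≡ΔX k = m≡o+n⇒+o≡+m-+n (X-step k)

  Tr-shift : ∀ {j} k → suc j ≤ L → Tr α e (suc j) k ≡ δ j k
  Tr-shift {j} k 1+j≤L with j ≟ k
  ... | yes refl = begin
    (+ ∣ ⟦ α , Mac e (suc j) , Mac e j ⟧ ∣) ⊘ X (suc j)  ≡⟨ cong (λ p → (+ ∣ p ∣) ⊘ X (suc j)) (⟦X₁₊ⱼ,Xⱼ⟧≡X₁₊ⱼ j) ⟩
    (+ X (suc j)) ⊘ X (suc j)                            ≡⟨ n⊘n≡1 (X>0 1+j≤L) ⟩
    1ℚ                                                   ≡⟨ δ-≡ {j} refl ⟨
    δ j j                                                ∎
  ... | no j≢k = begin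
    (+ ∣ ⟦ α , Mac e (suc j) , Mac e k ⟧ ∣) ⊘ X (suc j)  ≡⟨ cong (λ p → (+ ∣ p ∣) ⊘ X (suc j)) (⟦X₁₊ⱼ,Xₖ⟧≡⊥ j≢k) ⟩
    (+ ∣ ⊥ {n} ∣) ⊘ X (suc j)                            ≡⟨ cong (λ m → (+ m) ⊘ X (suc j)) (∣⊥∣≡0 n) ⟩
    (+ 0) ⊘ X (suc j)                                    ≡⟨ 0⊘n≡0 (X (suc j)) ⟩
    0ℚ                                                   ≡⟨ δ-≢ j≢k ⟨
    δ j k                                                ∎

  Tr₀≡ : ∀ k → Tr α e 0 k ≡ (+ c k) ⊘ ∣ E ∣
  Tr₀≡ k = cong (λ p → (+ ∣ ⟦ α , p , Mac e k ⟧ ∣) ⊘ ∣ p ∣) (sym E≡X₀)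

  no-chain-past-E : ∀ i → ¬ Chain α e i (suc (e i))
  no-chain-past-E i chain = <⇒≱ (chain (e i) ≤-refl) (W-maximal-on-E (proj₁ (reach i)) _)

  ∑e≡Σk·X : ∑ e ≡ Σℕ 1 L (λ k → k * X k)
  ∑e≡Σk·X = trans (∑-fibres e id (suc L) (s≤s ∘ proj₁ maximum)) (sym (Σℕ≡sumBelow 1 L (λ k → k * X k)))

  ∑e≡Σbinomial : ∑ e ≡ Σℕ 1 L (λ k → (suc k C 2) * c k)
  ∑e≡Σbinomial = begin
    ∑ e                                  ≡⟨ ∑-fibres e id (suc L) (s≤s ∘ proj₁ maximum) ⟩
    sumBelow (suc L) (λ k → k * X k)     ≡⟨ sumBelow-by-parts X c X-step (suc L) ⟩
    S + (suc L C 2) * X (suc L)          ≡⟨ cong (λ x → S + (suc L C 2) * x) (X-vanishes ≤-refl) ⟩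
    S + (suc L C 2) * 0                  ≡⟨ cong (_+_ S) (*-zeroʳ (suc L C 2)) ⟩
    S + 0                                ≡⟨ +-identityʳ S ⟩
    S                                    ≡⟨ Σℕ≡sumBelow 1 L (λ k → (suc k C 2) * c k) ⟨
    Σℕ 1 L (λ k → (suc k C 2) * c k)     ∎
    where
    S : ℕ
    S = sumBelow (suc L) (λ k → (suc k C 2) * c k)

  mean≡∑/n : ∀ {A} → (∀ i → A i ≡ e i) → mean A ≡ (+ ∑ e) ⊘ n
  mean≡∑/n {A} A≗e = cong (λ m → (+ m) ⊘ n) (begin
    sum (map A (allFin n))   ≡⟨ cong sum (map-tabulate id A) ⟩
    sum (List.tabulate A)    ≡⟨ sum-tabulate A ⟩
    ∑ A                      ≡⟨ sum-cong-≗ A≗e ⟩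
    ∑ e                      ∎)

  module Onto (covers : ∀ k → k ≤ L → ∃ λ i → (i ∈ E) × (e (α i) ≡ k)) where

    c>0 : ∀ {k} → k ≤ L → 0 < c k
    c>0 k≤L = let (i , i∈E , eαi≡k) = covers _ k≤L in ∈⇒∣∣>0 (∈⟦,⟧⁺ α i∈E (∈Mac⁺ e eαi≡k))

    X-strict : ∀ {k} → k ≤ L → X (suc k) < X k
    X-strict {k} k≤L = subst (X (suc k) <_) (sym (X-step k)) (m<n+m (X (suc k)) (c>0 k≤L))

    W-increasing : ∀ {i} → i ∉ E → W e i < W e (α i)
    W-increasing {i} i∉E = subst (λ m → X m < X (e (α i))) (sym (e-suc i∉E)) (X-strict (proj₁ maximum (α i)))

    W<∣E∣ : ∀ {i} → i ∉ E → W e i < ∣ E ∣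
    W<∣E∣ {i} i∉E = subst (λ m → X m < ∣ E ∣) (sym (e-suc i∉E))
      (≤-<-trans (X-antitone (s≤s z≤n)) (subst (X 1 <_) (cong ∣_∣ (sym E≡X₀)) (X-strict z≤n)))

    i₀ : Fin n
    i₀ = proj₁ (covers 0 z≤n)

    i₀∈E : i₀ ∈ E
    i₀∈E = proj₁ (proj₂ (covers 0 z≤n))

    ∈E-by-contradiction : ∀ {i} → ¬ i ∉ E → i ∈ E
    ∈E-by-contradiction {i} = decidable-stable (i ∈? E)

    Xeq≡E : Xeq e ≡ E
    Xeq≡E = ⊆-antisym (λ {i} i∈Xeq → ∈E-by-contradiction λ i∉E →
      <⇒≱ (W<∣E∣ i∉E) (subst (_≤ W e i) (W-∈E i₀∈E) (∈Xeq⁻ e i∈Xeq i₀))) E⊆Xeq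

    Xneq≡∁E : Xneq e ≡ ∁ E
    Xneq≡∁E = cong ∁ Xeq≡E

    W-drops-leaving-E : ∀ {i} → i ∈ E → α i ∉ E → W e (α i) < W e i
    W-drops-leaving-E i∈E αi∉E = subst (W e (α _) <_) (sym (W-∈E i∈E)) (W<∣E∣ αi∉E)

    D≡⟦E,∁E⟧ : Dset α e ≡ ⟦ α , E , ∁ E ⟧
    D≡⟦E,∁E⟧ = ⊆-antisym forward backward
      where
      forward : Dset α e ⊆ ⟦ α , E , ∁ E ⟧
      forward {i} i∈D = ∈⟦,⟧⁺ α (∈E-by-contradiction (λ i∉E → <-asym decrease (W-increasing i∉E)))
                                (x∉p⇒x∈∁p (λ αi∈E → <⇒≱ decrease (W-maximal-on-E αi∈E i)))
        where
        decrease : W e (α i) < W e i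
        decrease = ∈-tabulate-does⁻ (λ i → W e (α i) <? W e i) i∈D
      backward : ⟦ α , E , ∁ E ⟧ ⊆ Dset α e
      backward i∈⟦⟧ = let (i∈E , αi∈∁E) = ∈⟦,⟧⁻ α i∈⟦⟧ in
        ∈-tabulate-does⁺ (λ i → W e (α i) <? W e i) (W-drops-leaving-E i∈E (x∈∁p⇒x∉p αi∈∁E))

    C≡⟦E,E⟧ : Cset α e ≡ ⟦ α , E , E ⟧
    C≡⟦E,E⟧ = ⊆-antisym forward backward
      where
      forward : Cset α e ⊆ ⟦ α , E , E ⟧
      forward {i} i∈C = ∈⟦,⟧⁺ α i∈E (∈E-by-contradiction (λ αi∉E → <⇒≢ (W-drops-leaving-E i∈E αi∉E) constant))
        where
        constant : W e (α i) ≡ W e i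
        constant = ∈-tabulate-does⁻ (λ i → W e (α i) ≟ W e i) i∈C
        i∈E : i ∈ E
        i∈E = ∈E-by-contradiction (λ i∉E → <⇒≢ (W-increasing i∉E) (sym constant))
      backward : ⟦ α , E , E ⟧ ⊆ Cset α e
      backward i∈⟦⟧ = let (i∈E , αi∈E) = ∈⟦,⟧⁻ α i∈⟦⟧ in
        ∈-tabulate-does⁺ (λ i → W e (α i) ≟ W e i) (trans (W-∈E αi∈E) (sym (W-∈E i∈E)))

    I≡∁E : Iset α e ≡ ∁ E
    I≡∁E = ⊆-antisym forward backward
      where
      forward : Iset α e ⊆ ∁ E
      forward {i} i∈I = x∉p⇒x∈∁p (λ i∈E → <⇒≱ increase (W-maximal-on-E i∈E (α i)))
        where
        increase : W e i < W e (α i)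
        increase = ∈-tabulate-does⁻ (λ i → W e i <? W e (α i)) i∈I
      backward : ∁ E ⊆ Iset α e
      backward i∈∁E = ∈-tabulate-does⁺ (λ i → W e i <? W e (α i)) (W-increasing (x∈∁p⇒x∉p i∈∁E))

    D≡⟦Xeq,Xneq⟧ : Dset α e ≡ ⟦ α , Xeq e , Xneq e ⟧
    D≡⟦Xeq,Xneq⟧ = trans D≡⟦E,∁E⟧ (sym (cong₂ (λ U V → ⟦ α , U , V ⟧) Xeq≡E Xneq≡∁E))

    W-increasing-off-Xeq : ∀ {i} → i ∈ Xneq e → W e i < W e (α i)
    W-increasing-off-Xeq = W-increasing ∘ ∈Xneq⇒∉E

    ∣D∣≡X₁ : ∣ Dset α e ∣ ≡ X 1
    ∣D∣≡X₁ = +-cancelˡ-≡ (c 0) _ _ (begin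
      c 0 + ∣ Dset α e ∣                          ≡⟨ cong₂ (λ p q → ∣ ⟦ α , E , p ⟧ ∣ + ∣ q ∣) (sym E≡X₀) D≡⟦E,∁E⟧ ⟩
      ∣ ⟦ α , E , E ⟧ ∣ + ∣ ⟦ α , E , ∁ E ⟧ ∣      ≡⟨ ∣⟦U,V⟧∣+∣⟦U,∁V⟧∣≡∣U∣ α E E ⟩
      ∣ E ∣                                       ≡⟨ cong ∣_∣ E≡X₀ ⟩
      X 0                                         ≡⟨ X-step 0 ⟩
      c 0 + X 1                                   ∎)

    ∣I∣≡∣Xneq∣ : ∣ Iset α e ∣ ≡ ∣ Xneq e ∣
    ∣I∣≡∣Xneq∣ = cong ∣_∣ (trans I≡∁E (sym Xneq≡∁E))

    ∣C∣≡∣Xeq∣-X₁ : + ∣ Cset α e ∣ ≡ + ∣ Xeq e ∣ -ℤ + X 1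
    ∣C∣≡∣Xeq∣-X₁ = begin
      + ∣ Cset α e ∣        ≡⟨ cong (λ p → + ∣ p ∣) (trans C≡⟦E,E⟧ (cong (λ p → ⟦ α , E , p ⟧) E≡X₀)) ⟩
      + c 0                 ≡⟨ c≡ΔX 0 ⟩
      + X 0 -ℤ + X 1        ≡⟨ cong (λ p → + ∣ p ∣ -ℤ + X 1) (trans (sym E≡X₀) (sym Xeq≡E)) ⟩
      + ∣ Xeq e ∣ -ℤ + X 1  ∎

    arrowLength≡e : ∀ {A} → IsArrowLength α e A → ∀ i → A i ≡ e i
    arrowLength≡e isA i =
      arrowLength-unique α e isA (λ m m<ei → W-increasing (proj₂ (reach i) m m<ei)) (no-chain-past-E i)

    mean-arrowLength : ∀ {A} → IsArrowLength α e A → mean A ≡ (+ Σℕ 1 L (λ k → k * X k)) ⊘ n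
    mean-arrowLength isA = trans (mean≡∑/n (arrowLength≡e isA)) (cong (λ m → (+ m) ⊘ n) ∑e≡Σk·X)

    mean-arrowLength-binomial : ∀ {A} → IsArrowLength α e A →
      mean A ≡ ((+ ∣ Xeq e ∣) ⊘ n) *ℚ Σℚ 1 L (λ k → ((+ (suc k C 2)) ⊘ 1) *ℚ Tr α e 0 k)
    mean-arrowLength-binomial {A} isA = begin
      mean A
        ≡⟨ mean≡∑/n (arrowLength≡e isA) ⟩
      (+ ∑ e) ⊘ n
        ≡⟨ cong (λ m → (+ m) ⊘ n) ∑e≡Σbinomial ⟩
      (+ S) ⊘ n
        ≡⟨ ⊘-*-cancel n S ∣E∣>0 ⟨
      (+ ∣ E ∣) ⊘ n *ℚ (+ S) ⊘ ∣ E ∣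
        ≡⟨ cong (_*ℚ_ ((+ ∣ E ∣) ⊘ n)) (foldr-+ℚ-⊘ (λ k → suc k C 2) c (range 1 L) ∣E∣>0) ⟨
      (+ ∣ E ∣) ⊘ n *ℚ Σℚ 1 L (λ k → (+ (suc k C 2)) ⊘ 1 *ℚ (+ c k) ⊘ ∣ E ∣)
        ≡⟨ cong₂ (λ p σ → (+ ∣ p ∣) ⊘ n *ℚ σ) (sym Xeq≡E) (cong (foldr _+ℚ_ 0ℚ) (map-cong Tr-term (range 1 L))) ⟩
      (+ ∣ Xeq e ∣) ⊘ n *ℚ Σℚ 1 L (λ k → (+ (suc k C 2)) ⊘ 1 *ℚ Tr α e 0 k)
        ∎
      where
      S : ℕ
      S = Σℕ 1 L (λ k → (suc k C 2) * c k)
      ∣E∣>0 : 0 < ∣ E ∣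
      ∣E∣>0 = ∈⇒∣∣>0 i₀∈E
      Tr-term : ∀ k → (+ (suc k C 2)) ⊘ 1 *ℚ (+ c k) ⊘ ∣ E ∣ ≡ (+ (suc k C 2)) ⊘ 1 *ℚ Tr α e 0 k
      Tr-term k = cong (_*ℚ_ ((+ (suc k C 2)) ⊘ 1)) (sym (Tr₀≡ k))

theorem28 : ∀ (n : ℕ) (α : Fin n → Fin n) (E : Subset n) (e : Fin n → ℕ) (L : ℕ) (A : Fin n → ℕ) →
    Bijective _≡_ _≡_ α → EBound α E → IsReachingTime α E e → IsMaximum e L → IsArrowLength α e A →
    -- (a)
    ( (E ≡ Mac e 0 × (∀ k → k ≤ L → ∣ Mac e k ∣ ≤ ∣ E ∣))
    × (∀ i → i ∈ Xneq e → W e i ≤ W e (α i))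
    × (∀ s → Stable α E s → Stable α (Xeq e) s)
    × (∀ k → k ≤ L → + ∣ ⟦ α , E , Mac e k ⟧ ∣ ≡ + ∣ Mac e k ∣ -ℤ + ∣ Mac e (suc k) ∣)
    × (∀ k → k ≤ L → ∣ Mac e k ∣ ≡ Σℕ k L (λ t → ∣ ⟦ α , E , Mac e t ⟧ ∣))
    × (∀ j k → suc j ≤ L → k ≤ L → Tr α e (suc j) k ≡ δ j k)
    × (∀ k → k ≤ L → Tr α e 0 k ≡ (+ ∣ Mac e k ∣ -ℤ + ∣ Mac e (suc k) ∣) ⊘ ∣ E ∣) )
    ×
    -- assume e(α(E)) = [0, L]
    ( ((∀ i → i ∈ E → e (α i) ≤ L) × (∀ k → k ≤ L → ∃ λ i → (i ∈ E) × (e (α i) ≡ k))) →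
      -- (b)
      ( (Xeq e ≡ E)
      × (Xneq e ≡ ∁ E)
      × (Dset α e ≡ ⟦ α , Xeq e , Xneq e ⟧)
      × (∀ i → i ∈ Xneq e → W e i < W e (α i))
      × (∣ Dset α e ∣ ≡ ∣ Mac e 1 ∣)
      × (∣ Iset α e ∣ ≡ ∣ Xneq e ∣)
      × (+ ∣ Cset α e ∣ ≡ + ∣ Xeq e ∣ -ℤ + ∣ Mac e 1 ∣) )
      ×
      -- (c)
      ( (mean A ≡ (+ Σℕ 1 L (λ k → k *ℕ ∣ Mac e k ∣)) ⊘ n)
      × (mean A ≡ ((+ ∣ Xeq e ∣) ⊘ n) *ℚ Σℚ 1 L (λ k → ((+ (suc k C 2)) ⊘ 1) *ℚ Tr α e 0 k)) ) )
theorem28 n α E e L A bij _ reach maximum isA =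
    ( (E≡X₀ , λ k _ → X≤∣E∣ k)
    , (λ i → W-nondecreasing ∘ ∈Xneq⇒∉E)
    , Xeq-stable
    , (λ k _ → c≡ΔX k)
    , (λ k → X≡Σc)
    , (λ j k 1+j≤L _ → Tr-shift k 1+j≤L)
    , (λ k _ → trans (Tr₀≡ k) (cong (_⊘ ∣ E ∣) (c≡ΔX k))) )
  , λ (_ , covers) → let open Onto covers in
    ( (Xeq≡E , Xneq≡∁E , D≡⟦Xeq,Xneq⟧ , (λ i → W-increasing-off-Xeq) , ∣D∣≡X₁ , ∣I∣≡∣Xneq∣ , ∣C∣≡∣Xeq∣-X₁)
    , (mean-arrowLength isA , mean-arrowLength-binomial isA) )
  where
  open Macrostates α E e reach bij L maximum
  open ReachingTime α E e reach using (E≡X₀)
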